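{- Let $\phi$ and $\phi'$ be conjunctions of literals and let $D=(x\equiv p)$ and $D'=(x\oplus z_1\oplus\dots\oplus z_k\equiv p')$ be xor-constraints with $x,z_1,\dots,z_k$ pairwise distinct variables. Given the clause sets $S=\{\phi\Rightarrow C : C\in\mathrm{cnf}(D)\}$ and $S'=\{\phi'\Rightarrow C : C\in\mathrm{cnf}(D')\}$, the set $\{(\phi\land\phi')\Rightarrow C : C\in\mathrm{cnf}(D+D')\}$ has $2^{k-1}$ clauses, and these can be derived from the clauses in $S$ and $S'$ with $2^{k-1}$ resolution steps.
   Context: An xor-constraint is an equation $x_1\oplus\dots\oplus x_n\equiv p$ with $p\in\{\bot,\top\}$; duplicates cancel. $D+E$ is the linear combination: concatenate left sides (cancelling duplicates) and xor the parities. $\mathrm{cnf}(D)$ is the straightforward CNF translation of $D$: all clauses over $\mathrm{vars}(D)$ each excluding exactly one assignment falsifying $D$. For a conjunction of literals $\lambda=l_1\land\dots\land l_r$ and a clause $C$, $\lambda\Rightarrow C$ denotes the clause $\neg l_1\lor\dots\lor\neg l_r\lor C$. A resolution step derives $C\lor E$ from $x\lor C$ and $\neg x\lor E$. -}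

module Defs where

open import Data.Nat using (ℕ; _≡ᵇ_)
open import Data.Bool using (Bool; true; false; not; if_then_else_; _xor_)
open import Data.List using (List; []; _∷_; _++_; map; foldr; concatMap; filterᵇ)
open import Data.List.Membership.Propositional using (_∈_)
open import Data.Product using (_×_; _,_; ∃; ∃-syntax; proj₁; proj₂)
open import Function.Bundles using (_⇔_)
open import Relation.Binary.PropositionalEquality using (_≡_)

Var : Set
Var = ℕ

data Lit : Set where
  pos : Var → Lit
  neg : Var → Lit

¬ₗ : Lit → Lit
¬ₗ (pos v) = neg v
¬ₗ (neg v) = pos v

-- A clause is a disjunction of literals, represented by a list;
-- clauses are compared as sets (see _≋_).
Clause : Set
Clause = List Lit

_≋_ : Clause → Clause → Set
A ≋ B = ∀ l → (l ∈ A) ⇔ (l ∈ B)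

Conj : Set
Conj = List Lit

_⇒_ : Conj → Clause → Clause
φ ⇒ C = map ¬ₗ φ ++ C

-- Xor-constraints  x₁ ⊕ … ⊕ xₙ ≡ p  (false = ⊥, true = ⊤).
record Xor : Set where
  constructor _≡ₓ_
  field
    lhs    : List Var
    parity : Bool
open Xor public

-- Toggling a variable in a list (duplicates cancel).
toggle : Var → List Var → List Var
toggle v [] = v ∷ []
toggle v (w ∷ ws) = if v ≡ᵇ w then ws else (w ∷ toggle v ws)

cancel : List Var → List Var
cancel = foldr toggle []

vars : Xor → List Var
vars D = cancel (lhs D)

_+ₓ_ : Xor → Xor → Xor
D +ₓ E = cancel (lhs D ++ lhs E) ≡ₓ (parity D xor parity E)

Assignment : Set
Assignment = List (Var × Bool)

assignments : List Var → List Assignment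
assignments [] = [] ∷ []
assignments (v ∷ vs) =
  concatMap (λ a → ((v , false) ∷ a) ∷ ((v , true) ∷ a) ∷ []) (assignments vs)

xorVal : Assignment → Bool
xorVal = foldr (λ vb acc → proj₂ vb xor acc) false

-- The clause over the assigned variables excluding exactly assignment a.
excluding : Assignment → Clause
excluding = map (λ { (v , false) → pos v ; (v , true) → neg v })

-- cnf(D): one clause per assignment over vars(D) falsifying D.
cnf : Xor → List Clause
cnf D = map excluding
  (filterᵇ (λ a → not (xorVal a ≡ᵇB parity D)) (assignments (vars D)))
  where
  _≡ᵇB_ : Bool → Bool → Bool
  b ≡ᵇB c = not (b xor c)

Resolvent : Clause → Clause → Clause → Set
Resolvent A B R = ∃[ x ] ∃[ C ] ∃[ E ]
  (A ≋ (pos x ∷ C)) × (B ≋ (neg x ∷ E)) × (R ≋ (C ++ E))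

-- A resolution derivation from premises S; the index lists the clauses
-- derived so far (most recent first), one per resolution step.
data Derivation (S : List Clause) : List Clause → Set where
  start : Derivation S []
  step  : ∀ {ds A B R} → Derivation S ds →
          A ∈ (S ++ ds) → B ∈ (S ++ ds) → Resolvent A B R →
          Derivation S (R ∷ ds)

-- Since x, z₁, …, zₖ are distinct, cancellation of duplicates is list
-- reversal, so vars(D′) = zₖ … z₁ x and x cancels in D + D′, leaving
-- vars(D + D′) = z₁ … zₖ. A clause of cnf(E) is exactly the clause excluding
-- an assignment over vars(E) that falsifies E; flipping one value flips
-- falsification, so a constraint on k variables has 2^(k-1) clauses.
-- If C excludes an assignment a over z₁ … zₖ falsifying D + D′, then a
-- extended by x := p falsifies D′, and the corresponding clause of D′
-- contains the literal of x opposite to the unit clause x ≡ p. Resolving the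
-- two on x gives (φ ∧ φ′) ⇒ C. Hence the target clauses themselves form a
-- derivation with one resolution step per clause.

module Submission where

open import Defs
open import Data.Nat using (_^_; _∸_; _≤_; _*_; suc; _≡ᵇ_)
open import Data.Nat.Properties using (≡ᵇ⇒≡; ≡⇒≡ᵇ; *-suc)
open import Data.Bool using (Bool; true; false; not; _xor_; T)
open import Data.Bool.Properties using (xor-assoc; xor-comm)
open import Data.List using (List; []; _∷_; _++_; map; length; reverse; concatMap; filterᵇ)
open import Data.List.Properties using (map-++; reverse-map; unfold-reverse; reverse-involutive; length-map; ++-assoc)
open import Data.List.Relation.Unary.All using (All; []; _∷_; tabulate)
open import Data.List.Relation.Unary.Any using (Any; here; there)
import Data.List.Relation.Unary.Any as Any
open import Data.List.Relation.Unary.AllPairs using (_∷_)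
open import Data.List.Relation.Unary.Unique.Propositional using (Unique)
open import Data.List.Relation.Unary.Unique.Propositional.Properties using (Unique[x∷xs]⇒x∉xs)
open import Data.List.Membership.Propositional using (_∈_; _∉_; find)
open import Data.List.Membership.Propositional.Properties using (∈-++⁺ˡ; ∈-++⁺ʳ; ∈-map⁺; ∈-map⁻; ∈-concatMap⁺; ∈-concatMap⁻; ∈-filter⁺; ∈-filter⁻)
open import Data.List.Relation.Binary.Permutation.Propositional using (_↭_; refl; prep; swap; trans; ↭-sym; ↭-trans; ↭⇒↭ₛ; module PermutationReasoning)
open import Data.List.Relation.Binary.Permutation.Propositional.Properties using (∈-resp-↭; ↭-reverse; ++-comm; shift; ++⁺ˡ)
open import Data.List.Relation.Binary.Permutation.Setoid.Properties using (Unique-resp-↭)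
open import Data.Product using (_×_; ∃-syntax; _,_; proj₁)
open import Data.Unit using (tt)
open import Data.Empty using (⊥-elim)
open import Function using (_∘_)
open import Function.Bundles using (mk⇔)
open import Relation.Nullary.Decidable using (T?)
open import Relation.Binary.PropositionalEquality using (_≡_; _≢_; refl; sym; cong; cong₂; subst; setoid; module ≡-Reasoning)
import Relation.Binary.PropositionalEquality as ≡

≡ᵇ-refl : ∀ v → (v ≡ᵇ v) ≡ true
≡ᵇ-refl v with v ≡ᵇ v | ≡⇒≡ᵇ v v refl
... | true | _ = refl

≡ᵇ-false : ∀ {v w} → v ≢ w → (v ≡ᵇ w) ≡ false
≡ᵇ-false {v} {w} v≢w with v ≡ᵇ w | ≡ᵇ⇒≡ v w
... | true  | eq = ⊥-elim (v≢w (eq tt))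
... | false | _  = refl

toggle-skip : ∀ {v w} L → v ≢ w → toggle v (w ∷ L) ≡ w ∷ toggle v L
toggle-skip _ v≢w rewrite ≡ᵇ-false v≢w = refl

toggle-fresh : ∀ v L → v ∉ L → toggle v L ≡ L ++ v ∷ []
toggle-fresh v [] _ = refl
toggle-fresh v (w ∷ ws) v∉ = begin
  toggle v (w ∷ ws)     ≡⟨ toggle-skip ws (v∉ ∘ here) ⟩
  w ∷ toggle v ws       ≡⟨ cong (w ∷_) (toggle-fresh v ws (v∉ ∘ there)) ⟩
  w ∷ ws ++ v ∷ []      ∎
  where open ≡-Reasoning

toggle-toggle : ∀ v L → v ∉ L → toggle v (toggle v L) ≡ L
toggle-toggle v [] _ rewrite ≡ᵇ-refl v = refl
toggle-toggle v (w ∷ ws) v∉ = begin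
  toggle v (toggle v (w ∷ ws))   ≡⟨ cong (toggle v) (toggle-skip ws v≢w) ⟩
  toggle v (w ∷ toggle v ws)     ≡⟨ toggle-skip (toggle v ws) v≢w ⟩
  w ∷ toggle v (toggle v ws)     ≡⟨ cong (w ∷_) (toggle-toggle v ws (v∉ ∘ there)) ⟩
  w ∷ ws                         ∎
  where
  open ≡-Reasoning
  v≢w = v∉ ∘ here

∉-reverse : ∀ {v : Var} (L : List Var) → v ∉ L → v ∉ reverse L
∉-reverse L v∉ = v∉ ∘ ∈-resp-↭ (↭-reverse L)

unique-reverse : ∀ {L : List Var} → Unique L → Unique (reverse L)
unique-reverse {L} = Unique-resp-↭ (setoid Var) (↭⇒↭ₛ (↭-sym (↭-reverse L)))

cancel-unique : ∀ L → Unique L → cancel L ≡ reverse L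
cancel-unique [] _ = refl
cancel-unique (v ∷ L) u@(_ ∷ uL) = begin
  toggle v (cancel L)     ≡⟨ cong (toggle v) (cancel-unique L uL) ⟩
  toggle v (reverse L)    ≡⟨ toggle-fresh v (reverse L) (∉-reverse L (Unique[x∷xs]⇒x∉xs u)) ⟩
  reverse L ++ v ∷ []     ≡⟨ sym (unfold-reverse v L) ⟩
  reverse (v ∷ L)         ∎
  where open ≡-Reasoning

vars-sum : ∀ x zs p p′ → Unique (x ∷ zs) →
  vars (((x ∷ []) ≡ₓ p) +ₓ ((x ∷ zs) ≡ₓ p′)) ≡ zs
vars-sum x zs p p′ u@(_ ∷ uzs) = begin
  cancel (toggle x (toggle x (cancel zs)))   ≡⟨ cong (cancel ∘ toggle x ∘ toggle x) (cancel-unique zs uzs) ⟩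
  cancel (toggle x (toggle x (reverse zs)))  ≡⟨ cong cancel (toggle-toggle x (reverse zs) x∉) ⟩
  cancel (reverse zs)                        ≡⟨ cancel-unique (reverse zs) (unique-reverse uzs) ⟩
  reverse (reverse zs)                       ≡⟨ reverse-involutive zs ⟩
  zs                                         ∎
  where
  open ≡-Reasoning
  x∉ = ∉-reverse zs (Unique[x∷xs]⇒x∉xs u)

extensions : Var → Assignment → List Assignment
extensions v a = ((v , false) ∷ a) ∷ ((v , true) ∷ a) ∷ []

∈-assignments⁻ : ∀ {a} L → a ∈ assignments L → map proj₁ a ≡ L
∈-assignments⁻ [] (here refl) = refl
∈-assignments⁻ (v ∷ vs) a∈ with find (∈-concatMap⁻ (extensions v) {assignments vs} a∈)
... | b , b∈ , here refl         = cong (v ∷_) (∈-assignments⁻ vs b∈)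
... | b , b∈ , there (here refl) = cong (v ∷_) (∈-assignments⁻ vs b∈)

∈-assignments⁺ : ∀ a → a ∈ assignments (map proj₁ a)
∈-assignments⁺ [] = here refl
∈-assignments⁺ ((v , b) ∷ a) =
  ∈-concatMap⁺ (extensions v) {assignments (map proj₁ a)} (Any.map (λ { refl → ∈-extensions b }) (∈-assignments⁺ a))
  where
  ∈-extensions : ∀ b → ((v , b) ∷ a) ∈ extensions v a
  ∈-extensions false = here refl
  ∈-extensions true  = there (here refl)

length-assignments : ∀ L → length (assignments L) ≡ 2 ^ length L
length-assignments [] = refl
length-assignments (v ∷ vs) = ≡.trans (length-extended (assignments vs))
  (cong (2 *_) (length-assignments vs))
  where
  length-extended : ∀ As → length (concatMap (extensions v) As) ≡ 2 * length As
  length-extended [] = refl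
  length-extended (a ∷ As) = ≡.trans (cong (suc ∘ suc) (length-extended As))
    (sym (*-suc 2 (length As)))

length-filter-extensions : ∀ (P : Assignment → Bool) v →
  (∀ a → P ((v , true) ∷ a) ≡ not (P ((v , false) ∷ a))) →
  ∀ As → length (filterᵇ P (concatMap (extensions v) As)) ≡ length As
length-filter-extensions P v flips [] = refl
length-filter-extensions P v flips (a ∷ As) with P ((v , false) ∷ a) in eq
... | false rewrite flips a | eq = cong suc (length-filter-extensions P v flips As)
... | true  rewrite flips a | eq = cong suc (length-filter-extensions P v flips As)

xorVal-↭ : ∀ {a b} → a ↭ b → xorVal a ≡ xorVal b
xorVal-↭ refl = refl
xorVal-↭ (prep (_ , c) a↭b) = cong (c xor_) (xorVal-↭ a↭b)
xorVal-↭ {(_ , c) ∷ (_ , d) ∷ _} (swap _ _ a↭b) = begin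
  c xor (d xor _)   ≡⟨ sym (xor-assoc c d _) ⟩
  (c xor d) xor _   ≡⟨ cong₂ _xor_ (xor-comm c d) (xorVal-↭ a↭b) ⟩
  (d xor c) xor _   ≡⟨ xor-assoc d c _ ⟩
  d xor (c xor _)   ∎
  where open ≡-Reasoning
xorVal-↭ (trans a↭b b↭c) = ≡.trans (xorVal-↭ a↭b) (xorVal-↭ b↭c)

-- The filter predicate of cnf: assignment a falsifies a constraint of parity q.
falsifies : Bool → Assignment → Bool
falsifies q a = not (not (xorVal a xor q))

falsifies-sound : ∀ r q → T (not (not (r xor q))) → r ≡ not q
falsifies-sound false true  _ = refl
falsifies-sound true  false _ = refl

falsifies-complete : ∀ q → T (not (not (not q xor q)))
falsifies-complete false = tt
falsifies-complete true  = tt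

falsifies-flip : ∀ q v a →
  falsifies q ((v , true) ∷ a) ≡ not (falsifies q ((v , false) ∷ a))
falsifies-flip q v a with xorVal a
... | false = refl
... | true  with q
...   | false = refl
...   | true  = refl

∈-cnf⁺ : ∀ D a → map proj₁ a ≡ vars D → xorVal a ≡ not (parity D) → excluding a ∈ cnf D
∈-cnf⁺ D a a-vars a-falsifies = ∈-map⁺ excluding
  (∈-filter⁺ (T? ∘ falsifies (parity D))
    (subst (λ L → a ∈ assignments L) a-vars (∈-assignments⁺ a))
    (subst (λ r → T (not (not (r xor parity D)))) (sym a-falsifies)
      (falsifies-complete (parity D))))

∈-cnf⁻ : ∀ D {C} → C ∈ cnf D →
  ∃[ a ] (map proj₁ a ≡ vars D × xorVal a ≡ not (parity D) × C ≡ excluding a)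
∈-cnf⁻ D C∈ with ∈-map⁻ excluding C∈
... | a , a∈ , refl with ∈-filter⁻ (T? ∘ falsifies (parity D)) {xs = assignments (vars D)} a∈
...   | a∈assignments , a-falsifies =
  a , ∈-assignments⁻ (vars D) a∈assignments ,
  falsifies-sound (xorVal a) (parity D) a-falsifies , refl

length-cnf : ∀ D v vs → vars D ≡ v ∷ vs → length (cnf D) ≡ 2 ^ length vs
length-cnf D v vs vars≡ = begin
  length (cnf D)
    ≡⟨ length-map excluding (filterᵇ P (assignments (vars D))) ⟩
  length (filterᵇ P (assignments (vars D)))
    ≡⟨ cong (length ∘ filterᵇ P ∘ assignments) vars≡ ⟩
  length (filterᵇ P (concatMap (extensions v) (assignments vs)))
    ≡⟨ length-filter-extensions P v (falsifies-flip (parity D) v) (assignments vs) ⟩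
  length (assignments vs)
    ≡⟨ length-assignments vs ⟩
  2 ^ length vs ∎
  where
  open ≡-Reasoning
  P = falsifies (parity D)

falseLit : Var → Bool → Lit
falseLit v false = pos v
falseLit v true  = neg v

cnf-unit : ∀ x p → cnf ((x ∷ []) ≡ₓ p) ≡ (falseLit x (not p) ∷ []) ∷ []
cnf-unit x false = refl
cnf-unit x true  = refl

↭⇒≋ : ∀ {A B : Clause} → A ↭ B → A ≋ B
↭⇒≋ A↭B _ = mk⇔ (∈-resp-↭ A↭B) (∈-resp-↭ (↭-sym A↭B))

excluding-∷ : ∀ v b a → excluding ((v , b) ∷ a) ≡ falseLit v b ∷ excluding a
excluding-∷ v false a = refl
excluding-∷ v true  a = refl

excluding-↭ : ∀ {a b} → a ↭ b → excluding a ↭ excluding b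
excluding-↭ refl            = refl
excluding-↭ (prep _ a↭b)    = prep _ (excluding-↭ a↭b)
excluding-↭ (swap _ _ a↭b)  = swap _ _ (excluding-↭ a↭b)
excluding-↭ (trans a↭b b↭c) = trans (excluding-↭ a↭b) (excluding-↭ b↭c)

Resolvable : List Clause → Clause → Set
Resolvable S R = ∃[ A ] ∃[ B ] (A ∈ S × B ∈ S × Resolvent A B R)

resolve-all : ∀ {S} Rs → All (Resolvable S) Rs → Derivation S Rs
resolve-all [] [] = start
resolve-all (R ∷ Rs) ((A , B , A∈ , B∈ , res) ∷ resolvable) =
  step (resolve-all Rs resolvable) (∈-++⁺ˡ A∈) (∈-++⁺ˡ B∈) res

-- Resolution on x, whichever of the two clauses contains x positively.
resolvable-on : ∀ {S A B R} x b C E → A ∈ S → B ∈ S →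
  A ↭ falseLit x b ∷ C → B ↭ falseLit x (not b) ∷ E → R ↭ C ++ E →
  Resolvable S R
resolvable-on {A = A} {B} x false C E A∈ B∈ A↭ B↭ R↭ =
  A , B , A∈ , B∈ , x , C , E , ↭⇒≋ A↭ , ↭⇒≋ B↭ , ↭⇒≋ R↭
resolvable-on {A = A} {B} x true C E A∈ B∈ A↭ B↭ R↭ =
  B , A , B∈ , A∈ , x , E , C , ↭⇒≋ B↭ , ↭⇒≋ A↭ , ↭⇒≋ (↭-trans R↭ (++-comm C E))

-- p ⊕ ¬(p ⊕ p′) = ¬p′: the parity left for D′ once x := p is added.
xor-not-cancel : ∀ p p′ → p xor not (p xor p′) ≡ not p′
xor-not-cancel false p′ = refl
xor-not-cancel true  false = refl
xor-not-cancel true  true  = refl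

-- A clause (φ ∧ φ′) ⇒ C of the combination, C excluding an
-- assignment a over z₁ … zₖ, is the resolvent on x of the unit clause
-- φ ⇒ (x ≡ p) with the clause φ′ ⇒ C′ of D′ where C′ excludes a extended by x := p.
resolvable-combined : ∀ (φ φ′ : Conj) x zs p p′ → Unique (x ∷ zs) →
  ∀ a → map proj₁ a ≡ zs → xorVal a ≡ not (p xor p′) →
  Resolvable (map (φ ⇒_) (cnf ((x ∷ []) ≡ₓ p)) ++ map (φ′ ⇒_) (cnf ((x ∷ zs) ≡ₓ p′)))
             ((φ ++ φ′) ⇒ excluding a)
resolvable-combined φ φ′ x zs p p′ u a a-vars a-falsifies =
  resolvable-on x p (map ¬ₗ φ′ ++ excluding a) (map ¬ₗ φ) B∈ A∈ B↭ A↭ R↭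
  where
  S  = map (φ ⇒_) (cnf ((x ∷ []) ≡ₓ p))
  S′ = map (φ′ ⇒_) (cnf ((x ∷ zs) ≡ₓ p′))
  unit = falseLit x (not p) ∷ []
  b = reverse a ++ (x , p) ∷ []

  b↭ : b ↭ (x , p) ∷ a
  b↭ = ↭-trans (++-comm (reverse a) ((x , p) ∷ [])) (prep (x , p) (↭-reverse a))

  b-vars : map proj₁ b ≡ vars ((x ∷ zs) ≡ₓ p′)
  b-vars = begin
    map proj₁ (reverse a ++ (x , p) ∷ [])  ≡⟨ map-++ proj₁ (reverse a) ((x , p) ∷ []) ⟩
    map proj₁ (reverse a) ++ x ∷ []        ≡⟨ cong (_++ x ∷ []) (reverse-map proj₁ a) ⟩
    reverse (map proj₁ a) ++ x ∷ []        ≡⟨ cong (λ L → reverse L ++ x ∷ []) a-vars ⟩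
    reverse zs ++ x ∷ []                   ≡⟨ sym (unfold-reverse x zs) ⟩
    reverse (x ∷ zs)                       ≡⟨ sym (cancel-unique (x ∷ zs) u) ⟩
    cancel (x ∷ zs)                        ∎
    where open ≡-Reasoning

  b-falsifies : xorVal b ≡ not p′
  b-falsifies = ≡.trans (xorVal-↭ b↭)
    (≡.trans (cong (p xor_) a-falsifies) (xor-not-cancel p p′))

  A∈ : (φ ⇒ unit) ∈ S ++ S′
  A∈ = ∈-++⁺ˡ (∈-map⁺ (φ ⇒_) (subst (unit ∈_) (sym (cnf-unit x p)) (here refl)))

  B∈ : (φ′ ⇒ excluding b) ∈ S ++ S′
  B∈ = ∈-++⁺ʳ S (∈-map⁺ (φ′ ⇒_) (∈-cnf⁺ ((x ∷ zs) ≡ₓ p′) b b-vars b-falsifies))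

  A↭ : φ ⇒ unit ↭ falseLit x (not p) ∷ map ¬ₗ φ
  A↭ = ++-comm (map ¬ₗ φ) unit

  B↭ : φ′ ⇒ excluding b ↭ falseLit x p ∷ map ¬ₗ φ′ ++ excluding a
  B↭ = begin
    map ¬ₗ φ′ ++ excluding b                       ↭⟨ ++⁺ˡ (map ¬ₗ φ′) (excluding-↭ b↭) ⟩
    map ¬ₗ φ′ ++ excluding ((x , p) ∷ a)           ≡⟨ cong (map ¬ₗ φ′ ++_) (excluding-∷ x p a) ⟩
    map ¬ₗ φ′ ++ falseLit x p ∷ excluding a        ↭⟨ shift (falseLit x p) (map ¬ₗ φ′) (excluding a) ⟩
    falseLit x p ∷ map ¬ₗ φ′ ++ excluding a        ∎
    where open PermutationReasoning

  R↭ : (φ ++ φ′) ⇒ excluding a ↭ (map ¬ₗ φ′ ++ excluding a) ++ map ¬ₗ φ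
  R↭ = begin
    map ¬ₗ (φ ++ φ′) ++ excluding a                ≡⟨ cong (_++ excluding a) (map-++ ¬ₗ φ φ′) ⟩
    (map ¬ₗ φ ++ map ¬ₗ φ′) ++ excluding a         ≡⟨ ++-assoc (map ¬ₗ φ) (map ¬ₗ φ′) (excluding a) ⟩
    map ¬ₗ φ ++ map ¬ₗ φ′ ++ excluding a           ↭⟨ ++-comm (map ¬ₗ φ) (map ¬ₗ φ′ ++ excluding a) ⟩
    (map ¬ₗ φ′ ++ excluding a) ++ map ¬ₗ φ         ∎
    where open PermutationReasoning

lemma2 : (φ φ′ : Conj) (x : Var) (zs : List Var) (p p′ : Bool) →
    Unique (x ∷ zs) → 1 ≤ length zs →
    let D  = (x ∷ []) ≡ₓ p
        D′ = (x ∷ zs) ≡ₓ p′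
        S  = map (φ ⇒_) (cnf D)
        S′ = map (φ′ ⇒_) (cnf D′)
        T  = map ((φ ++ φ′) ⇒_) (cnf (D +ₓ D′))
    in (length T ≡ 2 ^ (length zs ∸ 1))
       × (∃[ ds ] (Derivation (S ++ S′) ds
                   × (length ds ≡ 2 ^ (length zs ∸ 1))
                   × All (λ t → Any (t ≋_) ds) T))
lemma2 φ φ′ x [] p p′ u ()
lemma2 φ φ′ x (z ∷ zs) p p′ u _ =
  size , combination , resolve-all combination (tabulate combined-resolvable) , size ,
  tabulate (Any.map λ { refl → ↭⇒≋ refl })
  where
  D+D′        = ((x ∷ []) ≡ₓ p) +ₓ ((x ∷ z ∷ zs) ≡ₓ p′)
  combination = map ((φ ++ φ′) ⇒_) (cnf D+D′)
  vars-D+D′   = vars-sum x (z ∷ zs) p p′ u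

  size : length combination ≡ 2 ^ length zs
  size = ≡.trans (length-map _ (cnf D+D′)) (length-cnf D+D′ z zs vars-D+D′)

  combined-resolvable : ∀ {t} → t ∈ combination → Resolvable _ t
  combined-resolvable t∈ with ∈-map⁻ _ t∈
  ... | C , C∈ , refl with ∈-cnf⁻ D+D′ C∈
  ...   | a , a-vars , a-falsifies , refl = resolvable-combined φ φ′ x (z ∷ zs) p p′ u
    a (≡.trans a-vars vars-D+D′) a-falsifies
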